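{- Let $p$ be a prime and let $n,k\in\mathbb{N}$. Then for any positive integer $\alpha$, $$ {\rm ord}_p(k!S(n,k))\geq{\rm ord}_p\bigg(\left\lfloor\frac{n}{p^{\alpha-1}}\right\rfloor!\bigg)-\left\lfloor\frac{n-k}{p^{\alpha-1}(p-1)}\right\rfloor. $$
   Context: The Stirling numbers of the second kind $S(n,k)$ are defined by $x^n=\sum_{k=0}^n S(n,k)k!\binom{x}{k}$, with $S(0,0)=1$ and $S(n,k)=0$ for $k>n$. For a prime $p$ and nonzero integer $a$, ${\rm ord}_p(a)=\sup\{i\in\mathbb{N}: p^i\mid a\}$, with ${\rm ord}_p(0)=\infty$; $\lfloor\cdot\rfloor$ is the floor function. -}

module Defs where

open import Data.Nat using (ℕ; zero; suc; _+_; _*_; _∸_; _/_; _%_; _≤_)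
open import Data.Nat.Properties using (_≟_)
open import Data.Unit using (⊤)
open import Data.Empty using (⊥)
open import Relation.Nullary using (yes; no)

S : ℕ → ℕ → ℕ
S zero    zero    = 1
S zero    (suc k) = 0
S (suc n) zero    = 0
S (suc n) (suc k) = S n k + suc k * S n (suc k)

data ℕ∞ : Set where
  fin : ℕ → ℕ∞
  ∞   : ℕ∞

_+∞_ : ℕ∞ → ℕ∞ → ℕ∞
fin m +∞ fin n = fin (m + n)
fin m +∞ ∞     = ∞
∞     +∞ _     = ∞

_≤∞_ : ℕ∞ → ℕ∞ → Set
fin m ≤∞ fin n = m ≤ n
fin m ≤∞ ∞     = ⊤
∞     ≤∞ fin n = ⊥
∞     ≤∞ ∞     = ⊤

-- number of times p divides a, with fuel (only meaningful for p ≥ 2)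
ordAux : ℕ → ℕ → ℕ → ℕ
ordAux zero    p               a = 0
ordAux (suc f) zero            a = 0
ordAux (suc f) (suc zero)      a = 0
ordAux (suc f) (suc (suc q))   a with a % suc (suc q) ≟ 0
... | yes _ = suc (ordAux f (suc (suc q)) (a / suc (suc q)))
... | no  _ = 0

-- p-adic order ord_p(a) = sup{i : p^i ∣ a}, with ord_p(0) = ∞
-- (fuel a suffices since p^a > a for p ≥ 2)
ord : ℕ → ℕ → ℕ∞
ord p zero    = ∞
ord p (suc a) = fin (ordAux (suc a) p (suc a))

-- floor division, total (divisor 0 gives 0; only used with positive divisors)
_div_ : ℕ → ℕ → ℕ
m div zero    = 0
m div (suc d) = m / suc d

{-# OPTIONS --safe #-}

-- Write T(n,k) = k! S(n,k), q = p^β and d = q(p − 1). We show that p^ν_p(⌊n/q⌋!) divides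
-- p^⌊(n−k)/d⌋ T(n,k), by induction on k through the convolution T(n,k+1) = Σ_{j<n} C(n,j) T(j,k).
-- For the j-th summand two estimates combine.
-- By Legendre's formula ν_p(x!) − ν_p(⌊x/q⌋!) = Σ_{i=1}^{β} ⌊x/p^i⌋ is superadditive in x, so
-- ν_p(⌊n/q⌋!) ≤ ν_p(C(n,j)) + ν_p(⌊j/q⌋!) + ν_p(⌊(n−j)/q⌋!). And (p − 1) ν_p(m!) ≤ m − 1 gives
-- d ν_p(⌊(n−j)/q⌋!) ≤ n − j − 1, which is what ⌊(n−k−1)/d⌋ gains over ⌊(j−k)/d⌋.

module Submission where

open import Defs
open import Data.Fin using (Fin; toℕ; inject₁; fromℕ)
open import Data.Fin.Properties using (toℕ<n; toℕ-inject₁; toℕ-fromℕ)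
open import Data.Nat
open import Data.Nat.Combinatorics
  using (_C_; nCn≡1; k>n⇒nCk≡0; nCk+nC[k+1]≡[n+1]C[k+1]; nCk≡n!/k![n-k]!; k![n∸k]!∣n!)
open import Data.Nat.Divisibility
open import Data.Nat.DivMod using (m≡m%n+[m/n]*n; m%n<n; m*n/n≡m; m/n*n≡m; m/n*n≤m;
  m<n⇒m/n≡0; +-distrib-/-∣ʳ; /-monoˡ-≤; m*n%n≡0; m/n<m; n/1≡n; m/n/o≡m/[n*o])
open import Data.Nat.Induction using (<-rec)
open import Data.Nat.Primality using (Prime; euclidsLemma; ¬prime[0]; ¬prime[1])
open import Data.Nat.Properties
open import Data.Nat.Tactic.RingSolver using (solve-∀)
open import Data.Product using (∃-syntax; _×_; _,_)
open import Data.Sum using (_⊎_; inj₁; inj₂; [_,_])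
open import Data.Unit using (tt)
open import Function using (_∘_)
open import Relation.Binary.PropositionalEquality
open import Relation.Nullary using (¬_; yes; no; contradiction)

open import Algebra.Properties.Semiring.Sum +-*-semiring
  using (sum; sum-syntax; sum-cong-≗; ∑-distrib-+; *-distribˡ-sum; sum-init-last; sum-replicate-zero)

^-monoʳ-∣ : ∀ m {i j} → i ≤ j → m ^ i ∣ m ^ j
^-monoʳ-∣ m {i} {j} i≤j = divides (m ^ (j ∸ i)) (begin
  m ^ j             ≡⟨ cong (m ^_) (m+[n∸m]≡n i≤j) ⟨
  m ^ (i + (j ∸ i)) ≡⟨ ^-distribˡ-+-* m i (j ∸ i) ⟩
  m ^ i * m ^ (j ∸ i) ≡⟨ *-comm (m ^ i) _ ⟩
  m ^ (j ∸ i) * m ^ i ∎)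
  where open ≡-Reasoning

m^i∣m^e*u⇒i≤e : ∀ m .{{_ : NonZero m}} i e {u} → ¬ m ∣ u → m ^ i ∣ m ^ e * u → i ≤ e
m^i∣m^e*u⇒i≤e m zero    e       m∤u _ = z≤n
m^i∣m^e*u⇒i≤e m (suc i) zero    m∤u m^i⁺∣u =
  contradiction (m*n∣⇒m∣ m (m ^ i) (subst (m ^ suc i ∣_) (*-identityˡ _) m^i⁺∣u)) m∤u
m^i∣m^e*u⇒i≤e m (suc i) (suc e) m∤u m^i⁺∣m^e⁺*u =
  s≤s (m^i∣m^e*u⇒i≤e m i e m∤u
    (*-cancelˡ-∣ m (subst (m ^ suc i ∣_) (*-assoc m (m ^ e) _) m^i⁺∣m^e⁺*u)))

suc-/-dichotomy : ∀ n d .{{_ : NonZero d}} →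
  (suc n / d ≡ n / d × ¬ d ∣ suc n) ⊎ suc n ≡ d * suc (n / d)
suc-/-dichotomy n d with m≤n⇒m<n∨m≡n (m%n<n n d)
... | inj₁ 1+r<d = inj₁ (1+n/d≡n/d , d∤1+n)
  where
  open ≤-Reasoning
  1+n≡1+r+q*d : suc n ≡ suc (n % d) + n / d * d
  1+n≡1+r+q*d = cong suc (m≡m%n+[m/n]*n n d)
  1+n/d≡n/d : suc n / d ≡ n / d
  1+n/d≡n/d = begin-equality
    suc n / d                        ≡⟨ cong (_/ d) 1+n≡1+r+q*d ⟩
    (suc (n % d) + n / d * d) / d     ≡⟨ +-distrib-/-∣ʳ (suc (n % d)) (n∣m*n (n / d)) ⟩
    suc (n % d) / d + n / d * d / d   ≡⟨ cong₂ _+_ (m<n⇒m/n≡0 1+r<d) (m*n/n≡m (n / d) d) ⟩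
    n / d                             ∎
  d∤1+n : ¬ d ∣ suc n
  d∤1+n d∣1+n = <⇒≱ (n<1+n n) (begin
    suc n           ≡⟨ m/n*n≡m d∣1+n ⟨
    suc n / d * d   ≡⟨ cong (_* d) 1+n/d≡n/d ⟩
    n / d * d       ≤⟨ m/n*n≤m n d ⟩
    n               ∎)
... | inj₂ 1+r≡d = inj₂ (begin
  suc n                   ≡⟨ cong suc (m≡m%n+[m/n]*n n d) ⟩
  suc (n % d) + n / d * d ≡⟨ cong₂ _+_ 1+r≡d (*-comm (n / d) d) ⟩
  d + d * (n / d)         ≡⟨ *-suc d (n / d) ⟨
  d * suc (n / d)         ∎)
  where open ≡-Reasoning

/-superadditive : ∀ a b d .{{_ : NonZero d}} → a / d + b / d ≤ (a + b) / d
/-superadditive a b d = begin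
  a / d + b / d                 ≡⟨ m*n/n≡m (a / d + b / d) d ⟨
  (a / d + b / d) * d / d       ≤⟨ /-monoˡ-≤ d (begin
    (a / d + b / d) * d           ≡⟨ *-distribʳ-+ d (a / d) (b / d) ⟩
    a / d * d + b / d * d         ≤⟨ +-mono-≤ (m/n*n≤m a d) (m/n*n≤m b d) ⟩
    a + b                         ∎) ⟩
  (a + b) / d                   ∎
  where open ≤-Reasoning

m*n≤o⇒n+p/m≤[o+p]/m : ∀ {m n o} p .{{_ : NonZero m}} → m * n ≤ o → n + p / m ≤ (o + p) / m
m*n≤o⇒n+p/m≤[o+p]/m {m} {n} {o} p m*n≤o = begin
  n + p / m           ≡⟨ +-comm n (p / m) ⟩
  p / m + n           ≡⟨ cong (p / m +_) (m*n/n≡m n m) ⟨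
  p / m + n * m / m   ≡⟨ +-distrib-/-∣ʳ p (n∣m*n n) ⟨
  (p + n * m) / m     ≤⟨ /-monoˡ-≤ m (subst (p + n * m ≤_) (+-comm p o) (+-monoʳ-≤ p n*m≤o)) ⟩
  (o + p) / m         ∎
  where
  open ≤-Reasoning
  n*m≤o : n * m ≤ o
  n*m≤o = subst (_≤ o) (*-comm m n) m*n≤o

div≡/ : ∀ m n .{{_ : NonZero n}} → m div n ≡ m / n
div≡/ m (suc n) = refl

∣-sum : ∀ {d n} (f : Fin n → ℕ) → (∀ i → d ∣ f i) → d ∣ sum f
∣-sum {n = zero}  f d∣f = _ ∣0
∣-sum {n = suc n} f d∣f = ∣m∣n⇒∣m+n (d∣f Fin.zero) (∣-sum (f ∘ Fin.suc) (d∣f ∘ Fin.suc))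

-- Surjection numbers k! S(n,k)

S-< : ∀ {n k} → n < k → S n k ≡ 0
S-< {zero}  {suc k} _         = refl
S-< {suc n} {suc k} (s≤s n<k) rewrite S-< n<k | S-< (m<n⇒m<1+n n<k) = *-zeroʳ (suc k)

surj : ℕ → ℕ → ℕ
surj n k = k ! * S n k

surj-< : ∀ {n k} → n < k → surj n k ≡ 0
surj-< {n} {k} n<k rewrite S-< n<k = *-zeroʳ (k !)

surj-suc-suc : ∀ n k → surj (suc n) (suc k) ≡ suc k * (surj n k + surj n (suc k))
surj-suc-suc n k = k⁺*f*[a+k⁺*b]≡k⁺*[f*a+k⁺*f*b] k (k !) (S n k) (S n (suc k))
  where
  k⁺*f*[a+k⁺*b]≡k⁺*[f*a+k⁺*f*b] : ∀ k f a b →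
    (suc k * f) * (a + suc k * b) ≡ suc k * (f * a + (suc k * f) * b)
  k⁺*f*[a+k⁺*b]≡k⁺*[f*a+k⁺*f*b] = solve-∀

sum-init-last-ℕ : ∀ n (g : ℕ → ℕ) → ∑[ j < suc n ] g (toℕ j) ≡ ∑[ j < n ] g (toℕ j) + g n
sum-init-last-ℕ n g = begin
  ∑[ j < suc n ] g (toℕ j)                             ≡⟨ sum-init-last {n} (g ∘ toℕ) ⟩
  ∑[ j < n ] g (toℕ (inject₁ j)) + g (toℕ (fromℕ n))
    ≡⟨ cong₂ _+_ (sum-cong-≗ {n} (cong g ∘ toℕ-inject₁)) (cong g (toℕ-fromℕ n)) ⟩
  ∑[ j < n ] g (toℕ j) + g n                           ∎
  where open ≡-Reasoning

binomialTransform : (ℕ → ℕ) → ℕ → ℕ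
binomialTransform f n = ∑[ j < suc n ] ((n C toℕ j) * f (toℕ j))

binomialTransform-cong : ∀ {f g} n → (∀ j → f j ≡ g j) → binomialTransform f n ≡ binomialTransform g n
binomialTransform-cong n f≗g = sum-cong-≗ {suc n} (λ j → cong ((n C toℕ j) *_) (f≗g (toℕ j)))

binomialTransform-0 : ∀ n → binomialTransform (λ _ → 0) n ≡ 0
binomialTransform-0 n = trans (sum-cong-≗ {suc n} (λ j → *-zeroʳ (n C toℕ j))) (sum-replicate-zero (suc n))

binomialTransform-+ : ∀ f g n →
  binomialTransform (λ j → f j + g j) n ≡ binomialTransform f n + binomialTransform g n
binomialTransform-+ f g n = begin
  ∑[ j < suc n ] ((n C toℕ j) * (f (toℕ j) + g (toℕ j)))
    ≡⟨ sum-cong-≗ {suc n} (λ j → *-distribˡ-+ (n C toℕ j) (f (toℕ j)) (g (toℕ j))) ⟩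
  ∑[ j < suc n ] ((n C toℕ j) * f (toℕ j) + (n C toℕ j) * g (toℕ j))
    ≡⟨ ∑-distrib-+ {suc n} (λ j → (n C toℕ j) * f (toℕ j)) (λ j → (n C toℕ j) * g (toℕ j)) ⟩
  binomialTransform f n + binomialTransform g n
    ∎
  where open ≡-Reasoning

binomialTransform-* : ∀ c f n → binomialTransform (λ j → c * f j) n ≡ c * binomialTransform f n
binomialTransform-* c f n = begin
  ∑[ j < suc n ] ((n C toℕ j) * (c * f (toℕ j)))
    ≡⟨ sum-cong-≗ {suc n} (λ j → x*[c*y]≡c*[x*y] (n C toℕ j) c (f (toℕ j))) ⟩
  ∑[ j < suc n ] (c * ((n C toℕ j) * f (toℕ j)))
    ≡⟨ *-distribˡ-sum {suc n} c (λ j → (n C toℕ j) * f (toℕ j)) ⟨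
  c * binomialTransform f n
    ∎
  where
  open ≡-Reasoning
  x*[c*y]≡c*[x*y] : ∀ x c y → x * (c * y) ≡ c * (x * y)
  x*[c*y]≡c*[x*y] = solve-∀

binomialTransform-pascal : ∀ f n →
  binomialTransform f (suc n) ≡ binomialTransform f n + binomialTransform (f ∘ suc) n
binomialTransform-pascal f n = begin
  f 0 + 0 + ∑[ j < suc n ] ((suc n C suc (toℕ j)) * f (suc (toℕ j)))
    ≡⟨ cong (f 0 + 0 +_) (sum-cong-≗ {suc n} (pascal ∘ toℕ)) ⟩
  f 0 + 0 + ∑[ j < suc n ] ((n C toℕ j) * f (suc (toℕ j)) + g (toℕ j))
    ≡⟨ cong (f 0 + 0 +_) (∑-distrib-+ {suc n} (λ j → (n C toℕ j) * f (suc (toℕ j))) (g ∘ toℕ)) ⟩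
  f 0 + 0 + (binomialTransform (f ∘ suc) n + ∑[ j < suc n ] g (toℕ j))
    ≡⟨ cong (λ x → f 0 + 0 + (binomialTransform (f ∘ suc) n + x)) (sum-init-last-ℕ n g) ⟩
  f 0 + 0 + (binomialTransform (f ∘ suc) n + (∑[ j < n ] g (toℕ j) + (n C suc n) * f (suc n)))
    ≡⟨ cong (λ x → f 0 + 0 + (binomialTransform (f ∘ suc) n + (∑[ j < n ] g (toℕ j) + x * f (suc n))))
            (k>n⇒nCk≡0 (n<1+n n)) ⟩
  f 0 + 0 + (binomialTransform (f ∘ suc) n + (∑[ j < n ] g (toℕ j) + 0))
    ≡⟨ a+[b+[c+0]]≡a+c+b (f 0 + 0) (binomialTransform (f ∘ suc) n) (∑[ j < n ] g (toℕ j)) ⟩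
  binomialTransform f n + binomialTransform (f ∘ suc) n
    ∎
  where
  open ≡-Reasoning
  g : ℕ → ℕ
  g j = (n C suc j) * f (suc j)
  pascal : ∀ j → (suc n C suc j) * f (suc j) ≡ (n C j) * f (suc j) + g j
  pascal j = trans (cong (_* f (suc j)) (sym (nCk+nC[k+1]≡[n+1]C[k+1] n j)))
                   (*-distribʳ-+ (f (suc j)) (n C j) (n C suc j))
  a+[b+[c+0]]≡a+c+b : ∀ a b c → a + (b + (c + 0)) ≡ a + c + b
  a+[b+[c+0]]≡a+c+b = solve-∀

binomialTransform-surj∘suc : ∀ k n → binomialTransform (λ j → surj (suc j) (suc k)) n
  ≡ suc k * (binomialTransform (λ j → surj j k) n + binomialTransform (λ j → surj j (suc k)) n)
binomialTransform-surj∘suc k n = begin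
  binomialTransform (λ j → surj (suc j) (suc k)) n
    ≡⟨ binomialTransform-cong n (λ j → surj-suc-suc j k) ⟩
  binomialTransform (λ j → suc k * (surj j k + surj j (suc k))) n
    ≡⟨ binomialTransform-* (suc k) (λ j → surj j k + surj j (suc k)) n ⟩
  suc k * binomialTransform (λ j → surj j k + surj j (suc k)) n
    ≡⟨ cong (suc k *_) (binomialTransform-+ (λ j → surj j k) (λ j → surj j (suc k)) n) ⟩
  suc k * (binomialTransform (λ j → surj j k) n + binomialTransform (λ j → surj j (suc k)) n)
    ∎
  where open ≡-Reasoning

binomialTransform-surj : ∀ k n → binomialTransform (λ j → surj j k) n ≡ surj n k + surj n (suc k)
binomialTransform-surj k zero = cong₂ _+_ (*-identityˡ (surj 0 k)) (sym (surj-< {0} {suc k} z<s))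
binomialTransform-surj zero (suc n) = begin
  binomialTransform (λ j → surj j 0) (suc n)
    ≡⟨ binomialTransform-pascal (λ j → surj j 0) n ⟩
  binomialTransform (λ j → surj j 0) n + binomialTransform (λ _ → 0) n
    ≡⟨ cong₂ _+_ (binomialTransform-surj 0 n) (binomialTransform-0 n) ⟩
  surj n 0 + surj n 1 + 0
    ≡⟨ +-identityʳ _ ⟩
  surj n 0 + surj n 1
    ≡⟨ trans (surj-suc-suc n 0) (*-identityˡ _) ⟨
  surj (suc n) 0 + surj (suc n) 1
    ∎
  where open ≡-Reasoning
binomialTransform-surj (suc k) (suc n) = begin
  binomialTransform (λ j → surj j (suc k)) (suc n)
    ≡⟨ binomialTransform-pascal (λ j → surj j (suc k)) n ⟩
  binomialTransform (λ j → surj j (suc k)) n + binomialTransform (λ j → surj (suc j) (suc k)) n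
    ≡⟨ cong (binomialTransform (λ j → surj j (suc k)) n +_) (binomialTransform-surj∘suc k n) ⟩
  binomialTransform (λ j → surj j (suc k)) n
    + suc k * (binomialTransform (λ j → surj j k) n + binomialTransform (λ j → surj j (suc k)) n)
    ≡⟨ cong₂ (λ x y → x + suc k * (y + x)) (binomialTransform-surj (suc k) n) (binomialTransform-surj k n) ⟩
  (b + c) + suc k * ((a + b) + (b + c))
    ≡⟨ rearrange a b c k ⟩
  suc k * (a + b) + suc (suc k) * (b + c)
    ≡⟨ cong₂ _+_ (surj-suc-suc n k) (surj-suc-suc n (suc k)) ⟨
  surj (suc n) (suc k) + surj (suc n) (suc (suc k))
    ∎
  where
  open ≡-Reasoning
  a = surj n k
  b = surj n (suc k)
  c = surj n (suc (suc k))
  rearrange : ∀ a b c k → (b + c) + suc k * ((a + b) + (b + c)) ≡ suc k * (a + b) + suc (suc k) * (b + c)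
  rearrange = solve-∀

surj-convolution : ∀ n k → surj n (suc k) ≡ ∑[ j < n ] ((n C toℕ j) * surj (toℕ j) k)
surj-convolution n k = +-cancelʳ-≡ _ _ _ (begin
  surj n (suc k) + surj n k               ≡⟨ +-comm (surj n (suc k)) (surj n k) ⟩
  surj n k + surj n (suc k)               ≡⟨ binomialTransform-surj k n ⟨
  binomialTransform (λ j → surj j k) n    ≡⟨ sum-init-last-ℕ n (λ j → (n C j) * surj j k) ⟩
  σ + (n C n) * surj n k                  ≡⟨ cong (λ x → σ + x * surj n k) (nCn≡1 n) ⟩
  σ + 1 * surj n k                        ≡⟨ cong (σ +_) (*-identityˡ (surj n k)) ⟩
  σ + surj n k                            ∎)
  where
  open ≡-Reasoning
  σ = ∑[ j < n ] ((n C toℕ j) * surj (toℕ j) k)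

-- p is written 2 + q so that ordAux p, and hence ord p, computes.
module Valuation (q : ℕ) (p-prime : Prime (2 + q)) where

  p : ℕ
  p = 2 + q

  ν : ℕ → ℕ
  ν a = ordAux a p a

  ordAux-∤ : ∀ f {a} → ¬ p ∣ a → ordAux (suc f) p a ≡ 0
  ordAux-∤ f {a} p∤a with a % p ≟ 0
  ... | yes a%p≡0 = contradiction (m%n≡0⇒n∣m a p a%p≡0) p∤a
  ... | no  _     = refl

  ordAux-*p : ∀ f c → ordAux (suc f) p (c * p) ≡ suc (ordAux f p c)
  ordAux-*p f c with c * p % p ≟ 0
  ... | yes _      = cong (suc ∘ ordAux f p) (m*n/n≡m c p)
  ... | no  c*p%p≢0 = contradiction (m*n%n≡0 c p) c*p%p≢0

  ordAux-factorisation : ∀ f a .{{_ : NonZero a}} → a ≤ f → ∃[ u ] ¬ p ∣ u × a ≡ p ^ ordAux f p a * u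
  ordAux-factorisation zero    (suc _) ()
  ordAux-factorisation (suc f) a a≤1+f with p ∣? a
  ... | no p∤a = a , p∤a , (begin
    a                              ≡⟨ *-identityˡ a ⟨
    p ^ 0 * a                      ≡⟨ cong (λ e → p ^ e * a) (ordAux-∤ f p∤a) ⟨
    p ^ ordAux (suc f) p a * a     ∎)
    where open ≡-Reasoning
  ... | yes (divides c refl) with ordAux-factorisation f c {{m*n≢0⇒m≢0 c}} c≤f
    where
    c≤f : c ≤ f
    c≤f = s≤s⁻¹ (<-≤-trans (m<m*n c p {{m*n≢0⇒m≢0 c}} (s≤s (s≤s z≤n))) a≤1+f)
  ...   | u , p∤u , c≡p^e*u = u , p∤u , (begin
    c * p                          ≡⟨ cong (_* p) c≡p^e*u ⟩
    p ^ e * u * p                  ≡⟨ x*y*p≡p*x*y (p ^ e) u p ⟩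
    p ^ suc e * u                  ≡⟨ cong (λ e → p ^ e * u) (ordAux-*p f c) ⟨
    p ^ ordAux (suc f) p (c * p) * u ∎)
    where
    open ≡-Reasoning
    e = ordAux f p c
    x*y*p≡p*x*y : ∀ x y p → x * y * p ≡ p * x * y
    x*y*p≡p*x*y = solve-∀

  ν-factorisation : ∀ a .{{_ : NonZero a}} → ∃[ u ] ¬ p ∣ u × a ≡ p ^ ν a * u
  ν-factorisation a = ordAux-factorisation a a ≤-refl

  p^ν∣ : ∀ a → p ^ ν a ∣ a
  p^ν∣ zero        = 1∣ 0
  p^ν∣ a@(suc _) with ν-factorisation a
  ... | u , _ , a≡p^ν*u = divides u (trans a≡p^ν*u (*-comm _ u))

  ∣⇒≤ν : ∀ {i} a .{{_ : NonZero a}} → p ^ i ∣ a → i ≤ ν a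
  ∣⇒≤ν {i} a p^i∣a with ν-factorisation a
  ... | u , p∤u , a≡p^ν*u = m^i∣m^e*u⇒i≤e p i (ν a) p∤u (subst (p ^ i ∣_) a≡p^ν*u p^i∣a)

  ν-p^e*u : ∀ e {u} → ¬ p ∣ u → ν (p ^ e * u) ≡ e
  ν-p^e*u e {zero}      p∤0 = contradiction (p ∣0) p∤0
  ν-p^e*u e {u@(suc _)} p∤u = ≤-antisym
    (m^i∣m^e*u⇒i≤e p _ e p∤u (p^ν∣ (p ^ e * u)))
    (∣⇒≤ν (p ^ e * u) {{m*n≢0 (p ^ e) u {{m^n≢0 p e}}}} (m∣m*n u))

  ν-∤ : ∀ {a} → ¬ p ∣ a → ν a ≡ 0
  ν-∤ {a} p∤a = trans (cong ν (sym (*-identityˡ a))) (ν-p^e*u 0 p∤a)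

  ν-p* : ∀ c .{{_ : NonZero c}} → ν (p * c) ≡ suc (ν c)
  ν-p* c with ν-factorisation c
  ... | u , p∤u , c≡p^ν*u = trans (cong ν p*c≡p^[1+ν]*u) (ν-p^e*u (suc (ν c)) p∤u)
    where
    p*c≡p^[1+ν]*u : p * c ≡ p ^ suc (ν c) * u
    p*c≡p^[1+ν]*u = trans (cong (p *_) c≡p^ν*u) (sym (*-assoc p (p ^ ν c) u))

  ν-* : ∀ a b .{{_ : NonZero a}} .{{_ : NonZero b}} → ν (a * b) ≡ ν a + ν b
  ν-* a b with ν-factorisation a | ν-factorisation b
  ... | u , p∤u , a≡p^ν*u | w , p∤w , b≡p^ν*w =
    trans (cong ν a*b≡p^[ν+ν]*uw) (ν-p^e*u (ν a + ν b) p∤uw)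
    where
    p∤uw : ¬ p ∣ u * w
    p∤uw p∣uw = [_,_] p∤u p∤w (euclidsLemma u w p-prime p∣uw)
    x*u*[y*w]≡x*y*[u*w] : ∀ x u y w → x * u * (y * w) ≡ x * y * (u * w)
    x*u*[y*w]≡x*y*[u*w] = solve-∀
    a*b≡p^[ν+ν]*uw : a * b ≡ p ^ (ν a + ν b) * (u * w)
    a*b≡p^[ν+ν]*uw = begin
      a * b                             ≡⟨ cong₂ _*_ a≡p^ν*u b≡p^ν*w ⟩
      p ^ ν a * u * (p ^ ν b * w)       ≡⟨ x*u*[y*w]≡x*y*[u*w] (p ^ ν a) u (p ^ ν b) w ⟩
      p ^ ν a * p ^ ν b * (u * w)       ≡⟨ cong (_* (u * w)) (^-distribˡ-+-* p (ν a) (ν b)) ⟨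
      p ^ (ν a + ν b) * (u * w)         ∎
      where open ≡-Reasoning

  ord-fin : ∀ a .{{_ : NonZero a}} → ord p a ≡ fin (ν a)
  ord-fin (suc a) = refl

  ^∣^*⇒≤ord : ∀ {i} F a → p ^ i ∣ p ^ F * a → fin i ≤∞ (ord p a +∞ fin F)
  ^∣^*⇒≤ord     F zero      _ = tt
  ^∣^*⇒≤ord {i} F a@(suc _) p^i∣p^F*a with ν-factorisation a
  ... | u , p∤u , a≡p^ν*u = subst (i ≤_) (+-comm F (ν a))
      (m^i∣m^e*u⇒i≤e p i (F + ν a) p∤u (subst (p ^ i ∣_) p^F*a≡p^[F+ν]*u p^i∣p^F*a))
    where
    p^F*a≡p^[F+ν]*u : p ^ F * a ≡ p ^ (F + ν a) * u
    p^F*a≡p^[F+ν]*u = begin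
      p ^ F * a                  ≡⟨ cong (p ^ F *_) a≡p^ν*u ⟩
      p ^ F * (p ^ ν a * u)      ≡⟨ *-assoc (p ^ F) _ u ⟨
      p ^ F * p ^ ν a * u        ≡⟨ cong (_* u) (^-distribˡ-+-* p F (ν a)) ⟨
      p ^ (F + ν a) * u          ∎
      where open ≡-Reasoning

  -- Legendre's formula

  ν! : ℕ → ℕ
  ν! n = ν (n !)

  ν!-suc : ∀ n → ν! (suc n) ≡ ν (suc n) + ν! n
  ν!-suc n = ν-* (suc n) (n !) {{_}} {{n !≢0}}

  ν!-legendre : ∀ n → ν! n ≡ n / p + ν! (n / p)
  ν!-legendre zero    = refl
  ν!-legendre (suc n) with suc-/-dichotomy n p
  ... | inj₁ (1+n/p≡n/p , p∤1+n) = begin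
    ν! (suc n)                   ≡⟨ ν!-suc n ⟩
    ν (suc n) + ν! n             ≡⟨ cong (_+ ν! n) (ν-∤ p∤1+n) ⟩
    ν! n                         ≡⟨ ν!-legendre n ⟩
    n / p + ν! (n / p)           ≡⟨ cong (λ m → m + ν! m) 1+n/p≡n/p ⟨
    suc n / p + ν! (suc n / p)   ∎
    where open ≡-Reasoning
  ... | inj₂ 1+n≡p*[1+n/p] = begin
    ν! (suc n)                   ≡⟨ ν!-suc n ⟩
    ν (suc n) + ν! n             ≡⟨ cong₂ _+_ (trans (cong ν 1+n≡p*[1+n/p]) (ν-p* (suc c))) (ν!-legendre n) ⟩
    suc (ν (suc c)) + (c + ν! c) ≡⟨ rearrange (ν (suc c)) c (ν! c) ⟩
    suc c + (ν (suc c) + ν! c)   ≡⟨ cong (suc c +_) (ν!-suc c) ⟨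
    suc c + ν! (suc c)           ≡⟨ cong (λ m → m + ν! m) 1+n/p≡1+c ⟨
    suc n / p + ν! (suc n / p)   ∎
    where
    open ≡-Reasoning
    c = n / p
    1+n/p≡1+c : suc n / p ≡ suc c
    1+n/p≡1+c = trans (cong (_/ p) (trans 1+n≡p*[1+n/p] (*-comm p (suc c)))) (m*n/n≡m (suc c) p)
    rearrange : ∀ a b c → suc a + (b + c) ≡ suc b + (a + c)
    rearrange = solve-∀

  ν!-binomial : ∀ {n k} → k ≤ n → ν! n ≡ ν (n C k) + (ν! k + ν! (n ∸ k))
  ν!-binomial {n} {k} k≤n = begin
    ν (n !)                                ≡⟨ cong ν n!≡nCk*[k!*[n∸k]!] ⟩
    ν ((n C k) * (k ! * (n ∸ k) !))        ≡⟨ ν-* (n C k) (k ! * (n ∸ k) !) {{nCk≢0}} ⟩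
    ν (n C k) + ν (k ! * (n ∸ k) !)        ≡⟨ cong (ν (n C k) +_) (ν-* (k !) ((n ∸ k) !) {{k !≢0}} {{(n ∸ k) !≢0}}) ⟩
    ν (n C k) + (ν! k + ν! (n ∸ k))        ∎
    where
    open ≡-Reasoning
    instance _ = k !* (n ∸ k) !≢0
    n!≡nCk*[k!*[n∸k]!] : n ! ≡ (n C k) * (k ! * (n ∸ k) !)
    n!≡nCk*[k!*[n∸k]!] = begin
      n !                                         ≡⟨ m/n*n≡m (k![n∸k]!∣n! k≤n) ⟨
      n ! / (k ! * (n ∸ k) !) * (k ! * (n ∸ k) !) ≡⟨ cong (_* (k ! * (n ∸ k) !)) (nCk≡n!/k![n-k]! k≤n) ⟨
      (n C k) * (k ! * (n ∸ k) !)                 ∎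
    nCk≢0 : NonZero (n C k)
    nCk≢0 = m*n≢0⇒m≢0 (n C k) {{subst NonZero n!≡nCk*[k!*[n∸k]!] (n !≢0)}}

  _/p^_ : ℕ → ℕ → ℕ
  x /p^ zero  = x
  x /p^ suc β = (x / p) /p^ β

  0/p^β≡0 : ∀ β → 0 /p^ β ≡ 0
  0/p^β≡0 zero    = refl
  0/p^β≡0 (suc β) = 0/p^β≡0 β

  /p^≡div : ∀ β x → x /p^ β ≡ x div (p ^ β)
  /p^≡div zero    x = sym (n/1≡n x)
  /p^≡div (suc β) x = begin
    (x / p) /p^ β      ≡⟨ /p^≡div β (x / p) ⟩
    (x / p) div (p ^ β) ≡⟨ div≡/ (x / p) (p ^ β) ⟩
    x / p / p ^ β      ≡⟨ m/n/o≡m/[n*o] x p (p ^ β) ⟩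
    x / (p * p ^ β)    ≡⟨ div≡/ x (p * p ^ β) ⟨
    x div (p * p ^ β)  ∎
    where
    open ≡-Reasoning
    instance
      _ = m^n≢0 p β
      _ = m^n≢0 p (suc β)

  p^β*[x/p^β]≤x : ∀ β x → p ^ β * (x /p^ β) ≤ x
  p^β*[x/p^β]≤x zero    x = ≤-reflexive (*-identityˡ x)
  p^β*[x/p^β]≤x (suc β) x = begin
    p * p ^ β * ((x / p) /p^ β)     ≡⟨ *-assoc p (p ^ β) _ ⟩
    p * (p ^ β * ((x / p) /p^ β))   ≤⟨ *-monoʳ-≤ p (p^β*[x/p^β]≤x β (x / p)) ⟩
    p * (x / p)                     ≡⟨ *-comm p (x / p) ⟩
    x / p * p                       ≤⟨ m/n*n≤m x p ⟩
    x                               ∎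
    where open ≤-Reasoning

  legendreSum : ℕ → ℕ → ℕ
  legendreSum zero    x = 0
  legendreSum (suc β) x = x / p + legendreSum β (x / p)

  ν!-split : ∀ β x → ν! x ≡ legendreSum β x + ν! (x /p^ β)
  ν!-split zero    x = refl
  ν!-split (suc β) x = begin
    ν! x                                                 ≡⟨ ν!-legendre x ⟩
    x / p + ν! (x / p)                                   ≡⟨ cong (x / p +_) (ν!-split β (x / p)) ⟩
    x / p + (legendreSum β (x / p) + ν! (x /p^ suc β))   ≡⟨ +-assoc (x / p) _ _ ⟨
    legendreSum (suc β) x + ν! (x /p^ suc β)             ∎
    where open ≡-Reasoning

  legendreSum-mono : ∀ β {a b} → a ≤ b → legendreSum β a ≤ legendreSum β b
  legendreSum-mono zero    a≤b = z≤n
  legendreSum-mono (suc β) a≤b = +-mono-≤ (/-monoˡ-≤ p a≤b) (legendreSum-mono β (/-monoˡ-≤ p a≤b))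

  legendreSum-superadditive : ∀ β a b → legendreSum β a + legendreSum β b ≤ legendreSum β (a + b)
  legendreSum-superadditive zero    a b = z≤n
  legendreSum-superadditive (suc β) a b = begin
    (a / p + legendreSum β (a / p)) + (b / p + legendreSum β (b / p))
      ≡⟨ +-assoc-comm (a / p) (legendreSum β (a / p)) (b / p) (legendreSum β (b / p)) ⟩
    (a / p + b / p) + (legendreSum β (a / p) + legendreSum β (b / p))
      ≤⟨ +-mono-≤ (/-superadditive a b p) (legendreSum-superadditive β (a / p) (b / p)) ⟩
    (a + b) / p + legendreSum β (a / p + b / p)
      ≤⟨ +-monoʳ-≤ ((a + b) / p) (legendreSum-mono β (/-superadditive a b p)) ⟩
    (a + b) / p + legendreSum β ((a + b) / p)
      ∎
    where
    open ≤-Reasoning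
    +-assoc-comm : ∀ a b c d → (a + b) + (c + d) ≡ (a + c) + (b + d)
    +-assoc-comm = solve-∀

  ν!-/p^-binomial : ∀ β {n k} → k ≤ n → ν! (n /p^ β) ≤ ν (n C k) + ν! (k /p^ β) + ν! ((n ∸ k) /p^ β)
  ν!-/p^-binomial β {n} {k} k≤n = +-cancelˡ-≤ (legendreSum β n) _ _ (begin
    G n + ν! (n /p^ β)
      ≡⟨ ν!-split β n ⟨
    ν! n
      ≡⟨ ν!-binomial k≤n ⟩
    ν (n C k) + (ν! k + ν! (n ∸ k))
      ≡⟨ cong₂ (λ x y → ν (n C k) + (x + y)) (ν!-split β k) (ν!-split β (n ∸ k)) ⟩
    ν (n C k) + ((G k + ν! (k /p^ β)) + (G (n ∸ k) + ν! ((n ∸ k) /p^ β)))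
      ≡⟨ rearrange (ν (n C k)) (G k) (ν! (k /p^ β)) (G (n ∸ k)) (ν! ((n ∸ k) /p^ β)) ⟩
    (G k + G (n ∸ k)) + (ν (n C k) + ν! (k /p^ β) + ν! ((n ∸ k) /p^ β))
      ≤⟨ +-monoˡ-≤ _ (subst (λ m → G k + G (n ∸ k) ≤ G m) (m+[n∸m]≡n k≤n)
                            (legendreSum-superadditive β k (n ∸ k))) ⟩
    G n + (ν (n C k) + ν! (k /p^ β) + ν! ((n ∸ k) /p^ β))
      ∎)
    where
    open ≤-Reasoning
    G = legendreSum β
    rearrange : ∀ c a x b y → c + ((a + x) + (b + y)) ≡ (a + b) + (c + x + y)
    rearrange = solve-∀

  [p∸1]*c+[c∸1]≡p*c∸1 : ∀ c → (p ∸ 1) * c + (c ∸ 1) ≡ p * c ∸ 1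
  [p∸1]*c+[c∸1]≡p*c∸1 zero    =
    trans (+-identityʳ _) (trans (*-zeroʳ (p ∸ 1)) (sym (cong (_∸ 1) (*-zeroʳ p))))
  [p∸1]*c+[c∸1]≡p*c∸1 (suc c) = +-comm ((p ∸ 1) * suc c) c

  ν!-bound : ∀ m → (p ∸ 1) * ν! m ≤ m ∸ 1
  ν!-bound = <-rec _ bound
    where
    bound : ∀ m → (∀ {c} → c < m → (p ∸ 1) * ν! c ≤ c ∸ 1) → (p ∸ 1) * ν! m ≤ m ∸ 1
    bound zero    _   = ≤-reflexive (*-zeroʳ (p ∸ 1))
    bound m@(suc _) rec = begin
      (p ∸ 1) * ν! m                  ≡⟨ cong ((p ∸ 1) *_) (ν!-legendre m) ⟩
      (p ∸ 1) * (c + ν! c)            ≡⟨ *-distribˡ-+ (p ∸ 1) c (ν! c) ⟩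
      (p ∸ 1) * c + (p ∸ 1) * ν! c    ≤⟨ +-monoʳ-≤ ((p ∸ 1) * c) (rec (m/n<m m p (s≤s (s≤s z≤n)))) ⟩
      (p ∸ 1) * c + (c ∸ 1)           ≡⟨ [p∸1]*c+[c∸1]≡p*c∸1 c ⟩
      p * c ∸ 1                       ≤⟨ ∸-monoˡ-≤ 1 (subst (_≤ m) (*-comm c p) (m/n*n≤m m p)) ⟩
      m ∸ 1                           ∎
      where
      open ≤-Reasoning
      c = m / p

  ν!-/p^-bound : ∀ β m → p ^ β * (p ∸ 1) * ν! (m /p^ β) ≤ m ∸ 1
  ν!-/p^-bound β m = begin
    p ^ β * (p ∸ 1) * ν! D          ≡⟨ *-assoc (p ^ β) (p ∸ 1) (ν! D) ⟩
    p ^ β * ((p ∸ 1) * ν! D)        ≤⟨ *-monoʳ-≤ (p ^ β) (ν!-bound D) ⟩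
    p ^ β * (D ∸ 1)                 ≡⟨ *-distribˡ-∸ (p ^ β) D 1 ⟩
    p ^ β * D ∸ p ^ β * 1           ≤⟨ ∸-mono (p^β*[x/p^β]≤x β m) (subst (1 ≤_) (sym (*-identityʳ (p ^ β))) (m^n>0 p β)) ⟩
    m ∸ 1                           ∎
    where
    open ≤-Reasoning
    D = m /p^ β

  -- Divisibility of k! S(n,k)

  module _ (β : ℕ) where

    d : ℕ
    d = p ^ β * (p ∸ 1)

    instance
      d≢0 : NonZero d
      d≢0 = m*n≢0 (p ^ β) (p ∸ 1) {{m^n≢0 p β}}

    exponent-shift : ∀ {n j k} → k ≤ j → j < n → ν! ((n ∸ j) /p^ β) + (j ∸ k) / d ≤ (n ∸ suc k) / d
    exponent-shift {n} {j} {k} k≤j j<n =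
      subst (λ x → ν! ((n ∸ j) /p^ β) + (j ∸ k) / d ≤ x / d) n∸j∸1+[j∸k]≡n∸[1+k]
        (m*n≤o⇒n+p/m≤[o+p]/m (j ∸ k) (ν!-/p^-bound β (n ∸ j)))
      where
      open ≡-Reasoning
      n∸j∸1+[j∸k]≡n∸[1+k] : n ∸ j ∸ 1 + (j ∸ k) ≡ n ∸ suc k
      n∸j∸1+[j∸k]≡n∸[1+k] = begin
        n ∸ j ∸ 1 + (j ∸ k)            ≡⟨ cong (_+ (j ∸ k)) (trans (∸-+-assoc n j 1) (cong (n ∸_) (+-comm j 1))) ⟩
        n ∸ suc j + (j ∸ k)            ≡⟨ +-comm (n ∸ suc j) (j ∸ k) ⟩
        (j ∸ k) + (n ∸ suc j)          ≡⟨ +-∸-comm (n ∸ suc j) k≤j ⟨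
        suc j + (n ∸ suc j) ∸ suc k    ≡⟨ cong (_∸ suc k) (m+[n∸m]≡n j<n) ⟩
        n ∸ suc k                      ∎

    ^ν!∣^*surj-term : ∀ {n j k} → k ≤ j → j < n →
      p ^ ν! (j /p^ β) ∣ p ^ ((j ∸ k) / d) * surj j k →
      p ^ ν! (n /p^ β) ∣ p ^ ((n ∸ suc k) / d) * ((n C j) * surj j k)
    ^ν!∣^*surj-term {n} {j} {k} k≤j j<n ih = begin
      p ^ ν! (n /p^ β)               ∣⟨ ^-monoʳ-∣ p (ν!-/p^-binomial β (<⇒≤ j<n)) ⟩
      p ^ (ν b + A + B)              ≡⟨ p^[c+a+b]≡p^c*p^a*p^b ⟩
      p ^ ν b * p ^ A * p ^ B        ∣⟨ *-pres-∣ (*-pres-∣ (p^ν∣ b) ih) (∣-refl {p ^ B}) ⟩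
      b * (p ^ F * t) * p ^ B        ≡⟨ rearrange ⟩
      p ^ (B + F) * (b * t)          ∣⟨ *-monoˡ-∣ (b * t) (^-monoʳ-∣ p (exponent-shift k≤j j<n)) ⟩
      p ^ ((n ∸ suc k) / d) * (b * t) ∎
      where
      open ∣-Reasoning
      b = n C j
      t = surj j k
      A = ν! (j /p^ β)
      B = ν! ((n ∸ j) /p^ β)
      F = (j ∸ k) / d
      p^[c+a+b]≡p^c*p^a*p^b : p ^ (ν b + A + B) ≡ p ^ ν b * p ^ A * p ^ B
      p^[c+a+b]≡p^c*p^a*p^b = trans (^-distribˡ-+-* p (ν b + A) B) (cong (_* p ^ B) (^-distribˡ-+-* p (ν b) A))
      c*[x*t]*y≡y*x*[c*t] : ∀ c x t y → c * (x * t) * y ≡ y * x * (c * t)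
      c*[x*t]*y≡y*x*[c*t] = solve-∀
      rearrange : b * (p ^ F * t) * p ^ B ≡ p ^ (B + F) * (b * t)
      rearrange = trans (c*[x*t]*y≡y*x*[c*t] b (p ^ F) t (p ^ B)) (cong (_* (b * t)) (sym (^-distribˡ-+-* p B F)))

    ^ν!∣^*surj : ∀ k n → p ^ ν! (n /p^ β) ∣ p ^ ((n ∸ k) / d) * surj n k
    ^ν!∣^*surj zero    zero    rewrite 0/p^β≡0 β = 1∣ _
    ^ν!∣^*surj zero    (suc n) rewrite *-zeroʳ (p ^ (suc n / d)) = _ ∣0
    ^ν!∣^*surj (suc k) n = subst (p ^ ν! (n /p^ β) ∣_) p^F*surj≡∑ (∣-sum _ term)
      where
      F = (n ∸ suc k) / d
      p^F*surj≡∑ : ∑[ j < n ] (p ^ F * ((n C toℕ j) * surj (toℕ j) k)) ≡ p ^ F * surj n (suc k)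
      p^F*surj≡∑ = trans (sym (*-distribˡ-sum {n} (p ^ F) _)) (cong (p ^ F *_) (sym (surj-convolution n k)))
      term : ∀ j → p ^ ν! (n /p^ β) ∣ p ^ F * ((n C toℕ j) * surj (toℕ j) k)
      term j with k ≤? toℕ j
      ... | yes k≤j = ^ν!∣^*surj-term k≤j (toℕ<n j) (^ν!∣^*surj k (toℕ j))
      ... | no  k≰j rewrite surj-< (≰⇒> k≰j) | *-zeroʳ (n C toℕ j) | *-zeroʳ (p ^ F) = _ ∣0

    ord-factorial-bound : ∀ n k →
      ord p ((n div (p ^ β)) !) ≤∞ (ord p (k ! * S n k) +∞ fin ((n ∸ k) div (p ^ β * (p ∸ 1))))
    ord-factorial-bound n k
      rewrite sym (/p^≡div β n) | div≡/ (n ∸ k) d {{d≢0}} | ord-fin ((n /p^ β) !) {{(n /p^ β) !≢0}}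
      = ^∣^*⇒≤ord ((n ∸ k) / d) (surj n k) (^ν!∣^*surj k n)

lemma2p1 : (p : ℕ) → Prime p → (n k α : ℕ) → 1 ≤ α →
    ord p ((n div (p ^ (α ∸ 1))) !)
      ≤∞ (ord p ((k !) * S n k) +∞ fin ((n ∸ k) div ((p ^ (α ∸ 1)) * (p ∸ 1))))
lemma2p1 0             0-prime = contradiction 0-prime ¬prime[0]
lemma2p1 1             1-prime = contradiction 1-prime ¬prime[1]
lemma2p1 (suc (suc q)) p-prime n k α _ = Valuation.ord-factorial-bound q p-prime (α ∸ 1) n k
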